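{- Every $12$-cap of dimension $7$ in $\mathbb{Z}_2^n$ has a basis of type $5\text{ - }5\text{ - }5\text{ - }5$.
   Context: Work in $\mathbb{Z}_2^n$. An affine combination of a set is a sum of an odd number of its distinct elements; $\operatorname{aff}(S)$ is the set of all affine combinations of elements of $S$, and the dimension of $S$ is the dimension of the affine flat $\operatorname{aff}(S)$. A basis for $S$ is a subset $B\subseteq S$ that is affinely independent (no element is an affine combination of the others) with $\operatorname{aff}(B)=\operatorname{aff}(S)$; its dependent set is $D=S\setminus B$. For $x\in D$, $B_x$ is the unique subset of $B$ whose elements sum to $x$. A quad is a set of four distinct elements summing to $\mathbf{0}$; a cap is a quad-free subset; a $k$-cap is a cap with $k$ elements. The type of $B$ is the list of the numbers $|B_x|$, $x\in D$, in nonincreasing order, separated by hyphens. -}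

module Defs where

open import Data.Bool using (Bool; false; _xor_)
open import Data.Nat using (ℕ; _+_; _%_)
open import Data.Vec using (Vec; zipWith; replicate)
open import Data.List using (List; foldr; length; _++_; _∷_)
open import Data.List.Relation.Unary.Unique.Propositional using (Unique)
open import Data.List.Relation.Binary.Sublist.Propositional using (_⊆_)
open import Data.List.Membership.Propositional using (_∈_; _∉_)
open import Data.Product using (Σ; _×_; ∃; ∃-syntax)
open import Relation.Nullary using (¬_)
open import Relation.Binary.PropositionalEquality using (_≡_; _≢_)

Point : ℕ → Set
Point n = Vec Bool n

_⊕_ : ∀ {n} → Point n → Point n → Point n
_⊕_ = zipWith _xor_

𝟎 : ∀ {n} → Point n
𝟎 = replicate _ false

sumP : ∀ {n} → List (Point n) → Point n
sumP = foldr _⊕_ 𝟎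

-- A finite set of points is a duplicate-free list; a subset of it is a
-- sublist (whose elements are then distinct).

-- x is an affine combination of S: a sum of an odd number of distinct
-- elements of S.
InAff : ∀ {n} → List (Point n) → Point n → Set
InAff S x = ∃[ T ] (T ⊆ S × length T % 2 ≡ 1 × sumP T ≡ x)

SameAff : ∀ {n} → List (Point n) → List (Point n) → Set
SameAff A B = ∀ x → (InAff A x → InAff B x) × (InAff B x → InAff A x)

AffIndep : ∀ {n} → List (Point n) → Set
AffIndep {n} B = ∀ (B₁ B₂ : List (Point n)) (x : Point n) →
  B ≡ B₁ ++ (x ∷ B₂) → ¬ InAff (B₁ ++ B₂) x

HasDim : ∀ {n} → List (Point n) → ℕ → Set
HasDim {n} S d = ∃[ P ] (Unique P × length P ≡ d + 1 × AffIndep P × SameAff P S)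

IsCap : ∀ {n} → List (Point n) → Set
IsCap S = ∀ T → T ⊆ S → length T ≡ 4 → sumP T ≢ 𝟎

IsKCap : ∀ {n} → ℕ → List (Point n) → Set
IsKCap k S = Unique S × length S ≡ k × IsCap S

IsBasis : ∀ {n} → List (Point n) → List (Point n) → Set
IsBasis B S = B ⊆ S × AffIndep B × SameAff B S

-- B (a basis for S) has type 5-5-5-5: the dependent set D = S \ B has
-- exactly 4 elements and for every x ∈ D the subset B_x has 5 elements.
-- (B_x is the unique subset of B summing to x.)
HasType5555 : ∀ {n} → List (Point n) → List (Point n) → Set
HasType5555 B S =
  length B + 4 ≡ length S ×
  (∀ x → x ∈ S → x ∉ B →
     ∃[ Bx ] (Bx ⊆ B × sumP Bx ≡ x × length Bx ≡ 5))

-- Fix a basis B of S and write D = S ∖ B. Two affinely independent spanning sets of the same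
-- flat have the same size (a pigeonhole count of their subfamilies), so |B| = 8 and |D| = 4.
-- Each x ∈ D has the circuit C_x = B_x ∪ {x}, a set of even size summing to 𝟎. In a cap of
-- distinct points every nonempty even zero-sum set has at least six elements, so |C_x| ≤ 9 is
-- 6 or 8, and B has type 5-5-5-5 exactly when all four circuits have six points.
-- Suppose |C₀| = 8. For any other circuit C, the set C₀ ⊕ C is again even with sum 𝟎, so it
-- has at least six points, while C₀ ∪ C lies in B ∪ {x₀, x}; counting forces |C| = 6 and
-- |C₀ ∩ C| = 4, and then every such C contains the only point z of B outside C₀. Fix a
-- second dependent point i and K = C₀ ∩ C_i, of size 4. Each of the remaining two circuits
-- either meets C_i in three points, so that C ⊕ C_i has six, or, since z ∉ K, meets K in at
-- most one point. Some k ∈ K therefore avoids the latter; exchanging k for i replaces every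
-- circuit through k by its sum with C_i and makes C_i the circuit of k, and all four new
-- circuits have six points.

module Submission where

open import Defs
open import Level using (Level)
open import Data.Bool using (Bool; true; false)
open import Data.Bool.Properties
  using (xor-comm; xor-assoc; xor-identityˡ; xor-identityʳ; xor-same) renaming (_≟_ to _≟ᵇ_)
open import Data.Nat using (ℕ; zero; suc; _+_; _*_; _∸_; _^_; _%_; _≤_; _<_; z≤n; s≤s; s≤s⁻¹; _≟_; _≤?_)
open import Data.Nat.Properties
  using (+-suc; +-comm; +-identityʳ; *-comm; *-suc; ≤-refl; ≤-trans; ≤-reflexive; ≤-antisym; <⇒≱; ≰⇒>;
         ≤∧≢⇒<; suc-injective; +-monoˡ-≤; +-mono-≤; +-cancelˡ-≤; +-cancelˡ-≡; +-cancelʳ-≡; *-cancelˡ-≤;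
         m+1+n≰m; ^-monoʳ-<; module ≤-Reasoning)
open import Data.Nat.DivMod using ([m+kn]%n≡m%n; %-distribˡ-+; m%n%n≡m%n)
open import Data.Fin using (Fin; zero; suc; combine; quotient; remainder)
import Data.Fin as Fin
open import Data.Fin.Properties using (any?; combine-injective; combine-remQuot; pigeonhole; <-irrefl)
open import Data.Fin.Subset
  using (Subset; ∣_∣; _∈_; _∉_; _⊆_; _∩_; _∪_; _─_; _-_; ⁅_⁆; ∁; ⊤; Nonempty) renaming (⊥ to ∅)
open import Data.Fin.Subset.Properties
  using (drop-there; drop-∷-⊆; _∈?_; _⊆?_; nonempty?; anySubset?; Empty-unique; ⊆-antisym; ⊆⊤;
         x∈⁅x⁆; x∈⁅y⁆⇒x≡y; ∣⁅x⁆∣≡1; ∣⊥∣≡0; ∣∁p∣≡n∸∣p∣; x∉p⇒x∈∁p; x∈∁p⇒x∉p; ∩-comm; ∩-zeroʳ;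
         x∈p∩q⁺; x∈p∩q⁻; x∈p∪q⁺; x∈p∪q⁻; x∈p∧x∉q⇒x∈p─q; x∈p∧x≢y⇒x∈p-y; p─q⊆p; p─⊥≡p;
         x∈p⇒∣p-x∣<∣p∣; p⊆q⇒∣p∣≤∣q∣; ∣p∩q∣≤∣q∣)
open import Data.List using (List; []; _∷_; length; lookup; _++_)
open import Data.List.Relation.Unary.All as All using ()
open import Data.List.Relation.Unary.AllPairs using (_∷_)
open import Data.List.Relation.Unary.Any as Any using (here; there)
open import Data.List.Relation.Unary.Any.Properties using (lookup-index)
open import Data.List.Relation.Unary.Unique.Propositional using (Unique)
import Data.List.Membership.Propositional as List
open import Data.List.Membership.Propositional.Properties using (∈-lookup)
import Data.List.Relation.Binary.Sublist.Propositional as Sublist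
open Sublist using ([]; _∷_; _∷ʳ_)
open import Data.Vec using ([]; _∷_; here; there)
open import Data.Vec.Properties
  using (zipWith-comm; zipWith-assoc; zipWith-identityˡ; zipWith-identityʳ; zipWith-inverseˡ; map-id; ≡-dec)
open import Data.Product using (∃; ∃-syntax; _×_; _,_; proj₁; proj₂)
open import Data.Sum using (_⊎_; inj₁; inj₂; [_,_])
open import Function using (_∘_)
open import Relation.Nullary using (¬_; Dec; yes; no)
open import Relation.Nullary.Decidable using (_×-dec_; ¬?)
open import Relation.Nullary.Negation using (contradiction)
open import Relation.Binary.PropositionalEquality hiding ([_])

private variable
  ℓ : Level
  A : Set ℓ
  n m : ℕ

-- The group ℤ₂ⁿ

⊕-comm : ∀ (x y : Point n) → x ⊕ y ≡ y ⊕ x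
⊕-comm = zipWith-comm xor-comm

⊕-assoc : ∀ (x y z : Point n) → (x ⊕ y) ⊕ z ≡ x ⊕ (y ⊕ z)
⊕-assoc = zipWith-assoc xor-assoc

⊕-identityˡ : ∀ (x : Point n) → 𝟎 ⊕ x ≡ x
⊕-identityˡ = zipWith-identityˡ xor-identityˡ

⊕-identityʳ : ∀ (x : Point n) → x ⊕ 𝟎 ≡ x
⊕-identityʳ = zipWith-identityʳ xor-identityʳ

⊕-self : ∀ (x : Point n) → x ⊕ x ≡ 𝟎
⊕-self x = trans (cong (_⊕ x) (sym (map-id x))) (zipWith-inverseˡ xor-same x)

⊕≡𝟎⇒≡ : ∀ {x y : Point n} → x ⊕ y ≡ 𝟎 → x ≡ y
⊕≡𝟎⇒≡ {x = x} {y} x⊕y≡𝟎 = begin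
  x             ≡⟨ sym (⊕-identityʳ x) ⟩
  x ⊕ 𝟎         ≡⟨ cong (x ⊕_) (sym (⊕-self y)) ⟩
  x ⊕ (y ⊕ y)   ≡⟨ sym (⊕-assoc x y y) ⟩
  (x ⊕ y) ⊕ y   ≡⟨ cong (_⊕ y) x⊕y≡𝟎 ⟩
  𝟎 ⊕ y         ≡⟨ ⊕-identityˡ y ⟩
  y             ∎
  where open ≡-Reasoning

⊕-interchange : ∀ (a b c d : Point n) → (a ⊕ b) ⊕ (c ⊕ d) ≡ (a ⊕ c) ⊕ (b ⊕ d)
⊕-interchange a b c d = begin
  (a ⊕ b) ⊕ (c ⊕ d)   ≡⟨ ⊕-assoc a b (c ⊕ d) ⟩
  a ⊕ (b ⊕ (c ⊕ d))   ≡⟨ cong (a ⊕_) (sym (⊕-assoc b c d)) ⟩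
  a ⊕ ((b ⊕ c) ⊕ d)   ≡⟨ cong (λ u → a ⊕ (u ⊕ d)) (⊕-comm b c) ⟩
  a ⊕ ((c ⊕ b) ⊕ d)   ≡⟨ cong (a ⊕_) (⊕-assoc c b d) ⟩
  a ⊕ (c ⊕ (b ⊕ d))   ≡⟨ sym (⊕-assoc a c (b ⊕ d)) ⟩
  (a ⊕ c) ⊕ (b ⊕ d)   ∎
  where open ≡-Reasoning

%2-+ : ∀ {a b r s} → a % 2 ≡ r → b % 2 ≡ s → (a + b) % 2 ≡ (r + s) % 2
%2-+ {a} {b} refl refl = %-distribˡ-+ a b 2

suc-even⇒odd : ∀ a → suc a % 2 ≡ 0 → a % 2 ≡ 1
suc-even⇒odd zero          ()
suc-even⇒odd (suc zero)    _ = refl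
suc-even⇒odd (suc (suc a)) h = suc-even⇒odd a h

odd⇒suc-even : ∀ a → a % 2 ≡ 1 → suc a % 2 ≡ 0
odd⇒suc-even (suc zero)    _ = refl
odd⇒suc-even (suc (suc a)) h = odd⇒suc-even a h

+-even-%2 : ∀ a {b} → b % 2 ≡ 0 → (a + b) % 2 ≡ a % 2
+-even-%2 a {b} b-even = begin
  (a + b) % 2         ≡⟨ %2-+ {a} {b} refl b-even ⟩
  (a % 2 + 0) % 2     ≡⟨ cong (_% 2) (+-identityʳ (a % 2)) ⟩
  a % 2 % 2           ≡⟨ m%n%n≡m%n a 2 ⟩
  a % 2               ∎
  where open ≡-Reasoning

-- Subsets of Fin m

-- Subset m and Point m are both Vec Bool m, so _⊕_ is also the symmetric
-- difference of subsets and 𝟎 is the empty subset ∅.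

∣p∣≡∣p∩q∣+∣p─q∣ : ∀ (p q : Subset m) → ∣ p ∣ ≡ ∣ p ∩ q ∣ + ∣ p ─ q ∣
∣p∣≡∣p∩q∣+∣p─q∣ []          []          = refl
∣p∣≡∣p∩q∣+∣p─q∣ (true ∷ p)  (true ∷ q)  = cong suc (∣p∣≡∣p∩q∣+∣p─q∣ p q)
∣p∣≡∣p∩q∣+∣p─q∣ (true ∷ p)  (false ∷ q) =
  trans (cong suc (∣p∣≡∣p∩q∣+∣p─q∣ p q)) (sym (+-suc _ _))
∣p∣≡∣p∩q∣+∣p─q∣ (false ∷ p) (true ∷ q)  = ∣p∣≡∣p∩q∣+∣p─q∣ p q
∣p∣≡∣p∩q∣+∣p─q∣ (false ∷ p) (false ∷ q) = ∣p∣≡∣p∩q∣+∣p─q∣ p q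

∣p∪q∣+∣p∩q∣≡∣p∣+∣q∣ : ∀ (p q : Subset m) → ∣ p ∪ q ∣ + ∣ p ∩ q ∣ ≡ ∣ p ∣ + ∣ q ∣
∣p∪q∣+∣p∩q∣≡∣p∣+∣q∣ []          []          = refl
∣p∪q∣+∣p∩q∣≡∣p∣+∣q∣ (true ∷ p)  (true ∷ q)  = cong suc (begin
  ∣ p ∪ q ∣ + suc ∣ p ∩ q ∣   ≡⟨ +-suc _ _ ⟩
  suc (∣ p ∪ q ∣ + ∣ p ∩ q ∣) ≡⟨ cong suc (∣p∪q∣+∣p∩q∣≡∣p∣+∣q∣ p q) ⟩
  suc (∣ p ∣ + ∣ q ∣)         ≡⟨ +-suc _ _ ⟨
  ∣ p ∣ + suc ∣ q ∣           ∎)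
  where open ≡-Reasoning
∣p∪q∣+∣p∩q∣≡∣p∣+∣q∣ (true ∷ p)  (false ∷ q) = cong suc (∣p∪q∣+∣p∩q∣≡∣p∣+∣q∣ p q)
∣p∪q∣+∣p∩q∣≡∣p∣+∣q∣ (false ∷ p) (true ∷ q)  =
  trans (cong suc (∣p∪q∣+∣p∩q∣≡∣p∣+∣q∣ p q)) (sym (+-suc _ _))
∣p∪q∣+∣p∩q∣≡∣p∣+∣q∣ (false ∷ p) (false ∷ q) = ∣p∪q∣+∣p∩q∣≡∣p∣+∣q∣ p q

∣p⊕q∣+2∣p∩q∣≡∣p∣+∣q∣ : ∀ (p q : Subset m) → ∣ p ⊕ q ∣ + 2 * ∣ p ∩ q ∣ ≡ ∣ p ∣ + ∣ q ∣
∣p⊕q∣+2∣p∩q∣≡∣p∣+∣q∣ []          []          = refl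
∣p⊕q∣+2∣p∩q∣≡∣p∣+∣q∣ (true ∷ p)  (true ∷ q)  = begin
  ∣ p ⊕ q ∣ + 2 * suc ∣ p ∩ q ∣           ≡⟨ cong (∣ p ⊕ q ∣ +_) (*-suc 2 ∣ p ∩ q ∣) ⟩
  ∣ p ⊕ q ∣ + suc (suc (2 * ∣ p ∩ q ∣))   ≡⟨ +-suc _ _ ⟩
  suc (∣ p ⊕ q ∣ + suc (2 * ∣ p ∩ q ∣))   ≡⟨ cong suc (+-suc _ _) ⟩
  suc (suc (∣ p ⊕ q ∣ + 2 * ∣ p ∩ q ∣))   ≡⟨ cong (λ (u : ℕ) → suc (suc u)) (∣p⊕q∣+2∣p∩q∣≡∣p∣+∣q∣ p q) ⟩
  suc (suc (∣ p ∣ + ∣ q ∣))               ≡⟨ cong suc (+-suc _ _) ⟨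
  suc (∣ p ∣ + suc ∣ q ∣)                 ∎
  where open ≡-Reasoning
∣p⊕q∣+2∣p∩q∣≡∣p∣+∣q∣ (true ∷ p)  (false ∷ q) = cong suc (∣p⊕q∣+2∣p∩q∣≡∣p∣+∣q∣ p q)
∣p⊕q∣+2∣p∩q∣≡∣p∣+∣q∣ (false ∷ p) (true ∷ q)  =
  trans (cong suc (∣p⊕q∣+2∣p∩q∣≡∣p∣+∣q∣ p q)) (sym (+-suc _ _))
∣p⊕q∣+2∣p∩q∣≡∣p∣+∣q∣ (false ∷ p) (false ∷ q) = ∣p⊕q∣+2∣p∩q∣≡∣p∣+∣q∣ p q

∣p⊕q∣%2 : ∀ (p q : Subset m) → ∣ p ⊕ q ∣ % 2 ≡ (∣ p ∣ + ∣ q ∣) % 2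
∣p⊕q∣%2 p q = begin
  ∣ p ⊕ q ∣ % 2                     ≡⟨ [m+kn]%n≡m%n ∣ p ⊕ q ∣ ∣ p ∩ q ∣ 2 ⟨
  (∣ p ⊕ q ∣ + ∣ p ∩ q ∣ * 2) % 2   ≡⟨ cong (λ u → (∣ p ⊕ q ∣ + u) % 2) (*-comm ∣ p ∩ q ∣ 2) ⟩
  (∣ p ⊕ q ∣ + 2 * ∣ p ∩ q ∣) % 2   ≡⟨ cong (_% 2) (∣p⊕q∣+2∣p∩q∣≡∣p∣+∣q∣ p q) ⟩
  (∣ p ∣ + ∣ q ∣) % 2               ∎
  where open ≡-Reasoning

⊕-even : ∀ (p q : Subset m) → ∣ p ∣ % 2 ≡ 0 → ∣ q ∣ % 2 ≡ 0 → ∣ p ⊕ q ∣ % 2 ≡ 0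
⊕-even p q p-even q-even = trans (∣p⊕q∣%2 p q) (trans (+-even-%2 ∣ p ∣ q-even) p-even)

x∈p⊕q⁻ : ∀ {x : Fin m} (p q : Subset m) → x ∈ p ⊕ q → x ∈ p × x ∉ q ⊎ x ∉ p × x ∈ q
x∈p⊕q⁻ (true ∷ p)  (false ∷ q) here = inj₁ (here , λ ())
x∈p⊕q⁻ (false ∷ p) (true ∷ q)  here = inj₂ ((λ ()) , here)
x∈p⊕q⁻ (_ ∷ p)     (_ ∷ q)     (there x∈p⊕q) with x∈p⊕q⁻ p q x∈p⊕q
... | inj₁ (x∈p , x∉q) = inj₁ (there x∈p , x∉q ∘ drop-there)
... | inj₂ (x∉p , x∈q) = inj₂ (x∉p ∘ drop-there , there x∈q)

x∈p⊕q⁺ : ∀ {x : Fin m} {p q : Subset m} → x ∈ p × x ∉ q ⊎ x ∉ p × x ∈ q → x ∈ p ⊕ q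
x∈p⊕q⁺ {q = false ∷ q} (inj₁ (here , _))          = here
x∈p⊕q⁺ {q = true ∷ q}  (inj₁ (here , x∉q))        = contradiction here x∉q
x∈p⊕q⁺ {p = false ∷ p} (inj₂ (_ , here))          = here
x∈p⊕q⁺ {p = true ∷ p}  (inj₂ (x∉p , here))        = contradiction here x∉p
x∈p⊕q⁺ {q = _ ∷ _}     (inj₁ (there x∈p , x∉q))   = there (x∈p⊕q⁺ (inj₁ (x∈p , x∉q ∘ there)))
x∈p⊕q⁺ {p = _ ∷ _}     (inj₂ (x∉p , there x∈q))   = there (x∈p⊕q⁺ (inj₂ (x∉p ∘ there , x∈q)))

x∈p─q⇒x∉q : ∀ {x : Fin m} {p q : Subset m} → x ∈ p ─ q → x ∉ q
x∈p─q⇒x∉q {p = _ ∷ _} {q = false ∷ _} here          ()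
x∈p─q⇒x∉q {p = _ ∷ _} {q = _ ∷ _}     (there x∈p─q) (there x∈q) = x∈p─q⇒x∉q x∈p─q x∈q

x∈p-y⇒x≢y : ∀ {x y : Fin m} {p : Subset m} → x ∈ p - y → x ≢ y
x∈p-y⇒x≢y {x = x} x∈p-y refl = x∈p─q⇒x∉q x∈p-y (x∈⁅x⁆ x)

0<∣p∣⇒Nonempty : ∀ {p : Subset m} → 0 < ∣ p ∣ → Nonempty p
0<∣p∣⇒Nonempty {p = true ∷ p}  _ = zero , here
0<∣p∣⇒Nonempty {p = false ∷ p} h with x , x∈p ← 0<∣p∣⇒Nonempty {p = p} h = suc x , there x∈p

Nonempty⇒0<∣p∣ : ∀ {p : Subset m} → Nonempty p → 0 < ∣ p ∣
Nonempty⇒0<∣p∣ (x , x∈p) = ≤-trans (s≤s z≤n) (x∈p⇒∣p-x∣<∣p∣ x∈p)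

x∈p⇒suc∣p-x∣≡∣p∣ : ∀ {x : Fin m} {p : Subset m} → x ∈ p → suc ∣ p - x ∣ ≡ ∣ p ∣
x∈p⇒suc∣p-x∣≡∣p∣ {x = x} {p} x∈p = begin
  suc ∣ p - x ∣               ≡⟨ cong (_+ ∣ p - x ∣) (sym (trans (cong ∣_∣ p∩⁅x⁆≡⁅x⁆) (∣⁅x⁆∣≡1 x))) ⟩
  ∣ p ∩ ⁅ x ⁆ ∣ + ∣ p - x ∣   ≡⟨ ∣p∣≡∣p∩q∣+∣p─q∣ p ⁅ x ⁆ ⟨
  ∣ p ∣                       ∎
  where
    open ≡-Reasoning
    p∩⁅x⁆≡⁅x⁆ : p ∩ ⁅ x ⁆ ≡ ⁅ x ⁆
    p∩⁅x⁆≡⁅x⁆ = ⊆-antisym (proj₂ ∘ x∈p∩q⁻ p ⁅ x ⁆)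
      (λ y∈⁅x⁆ → x∈p∩q⁺ (subst (_∈ p) (sym (x∈⁅y⁆⇒x≡y x y∈⁅x⁆)) x∈p , y∈⁅x⁆))

∣p∣≡1⇒≡ : ∀ {x y : Fin m} {p : Subset m} → ∣ p ∣ ≡ 1 → x ∈ p → y ∈ p → x ≡ y
∣p∣≡1⇒≡ {x = x} {y} ∣p∣≡1 x∈p y∈p with x Fin.≟ y
... | yes x≡y = x≡y
... | no  x≢y = contradiction (trans (x∈p⇒suc∣p-x∣≡∣p∣ x∈p) ∣p∣≡1) λ suc∣p-x∣≡1 →
                  <⇒≱ (Nonempty⇒0<∣p∣ (y , x∈p∧x≢y⇒x∈p-y y∈p (x≢y ∘ sym))) (≤-reflexive (suc-injective suc∣p-x∣≡1))

x∉p⇒∣p∪⁅x⁆∣≡suc∣p∣ : ∀ {x : Fin m} {p : Subset m} → x ∉ p → ∣ p ∪ ⁅ x ⁆ ∣ ≡ suc ∣ p ∣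
x∉p⇒∣p∪⁅x⁆∣≡suc∣p∣ {m} {x} {p} x∉p = begin
  ∣ p ∪ ⁅ x ⁆ ∣                   ≡⟨ +-identityʳ _ ⟨
  ∣ p ∪ ⁅ x ⁆ ∣ + 0               ≡⟨ cong (∣ p ∪ ⁅ x ⁆ ∣ +_) (∣⊥∣≡0 m) ⟨
  ∣ p ∪ ⁅ x ⁆ ∣ + ∣ ∅ {n = m} ∣   ≡⟨ cong (λ u → ∣ p ∪ ⁅ x ⁆ ∣ + ∣ u ∣) p∩⁅x⁆≡∅ ⟨
  ∣ p ∪ ⁅ x ⁆ ∣ + ∣ p ∩ ⁅ x ⁆ ∣   ≡⟨ ∣p∪q∣+∣p∩q∣≡∣p∣+∣q∣ p ⁅ x ⁆ ⟩
  ∣ p ∣ + ∣ ⁅ x ⁆ ∣               ≡⟨ cong (∣ p ∣ +_) (∣⁅x⁆∣≡1 x) ⟩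
  ∣ p ∣ + 1                       ≡⟨ +-comm ∣ p ∣ 1 ⟩
  suc ∣ p ∣                       ∎
  where
    open ≡-Reasoning
    p∩⁅x⁆≡∅ : p ∩ ⁅ x ⁆ ≡ ∅
    p∩⁅x⁆≡∅ = Empty-unique λ (y , y∈p∩⁅x⁆) →
      let (y∈p , y∈⁅x⁆) = x∈p∩q⁻ p ⁅ x ⁆ y∈p∩⁅x⁆ in x∉p (subst (_∈ p) (x∈⁅y⁆⇒x≡y x y∈⁅x⁆) y∈p)

x∈p⇒p⊕⁅x⁆≡p-x : ∀ {x : Fin m} {p : Subset m} → x ∈ p → p ⊕ ⁅ x ⁆ ≡ p - x
x∈p⇒p⊕⁅x⁆≡p-x {p = true ∷ p} here        = cong (false ∷_) (trans (⊕-identityʳ p) (sym (p─⊥≡p p)))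
x∈p⇒p⊕⁅x⁆≡p-x {p = b ∷ p}    (there x∈p) = cong₂ _∷_ (xor-identityʳ b) (x∈p⇒p⊕⁅x⁆≡p-x x∈p)

module _ {m} (A : Fin m → Subset m) where
  Avoids : Fin m → Subset m → Set
  Avoids k D = ∀ {j} → j ∈ D → k ∉ A j

  MeetsOnce : Subset m → Subset m → Set
  MeetsOnce K D = ∀ {j} → j ∈ D → ∣ K ∩ A j ∣ ≤ 1

  private
    meetsOnce-─ : ∀ {K D} j → MeetsOnce K D → MeetsOnce (K ─ A j) (D - j)
    meetsOnce-─ {K} j once {j′} j′∈D-j = ≤-trans (p⊆q⇒∣p∣≤∣q∣ K─Aⱼ∩Aⱼ′⊆K∩Aⱼ′) (once (p─q⊆p _ _ j′∈D-j))
      where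
        K─Aⱼ∩Aⱼ′⊆K∩Aⱼ′ : (K ─ A j) ∩ A j′ ⊆ K ∩ A j′
        K─Aⱼ∩Aⱼ′⊆K∩Aⱼ′ t∈ = let (t∈K─Aⱼ , t∈Aⱼ′) = x∈p∩q⁻ (K ─ A j) (A j′) t∈ in
                            x∈p∩q⁺ (p─q⊆p K (A j) t∈K─Aⱼ , t∈Aⱼ′)

    ∣D-j∣<∣K─Aⱼ∣ : ∀ {K D j} → j ∈ D → MeetsOnce K D → ∣ D ∣ < ∣ K ∣ → ∣ D - j ∣ < ∣ K ─ A j ∣
    ∣D-j∣<∣K─Aⱼ∣ {K} {D} {j} j∈D once ∣D∣<∣K∣ = s≤s⁻¹ (begin
      suc (suc ∣ D - j ∣)           ≡⟨ cong suc (x∈p⇒suc∣p-x∣≡∣p∣ j∈D) ⟩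
      suc ∣ D ∣                     ≤⟨ ∣D∣<∣K∣ ⟩
      ∣ K ∣                         ≡⟨ ∣p∣≡∣p∩q∣+∣p─q∣ K (A j) ⟩
      ∣ K ∩ A j ∣ + ∣ K ─ A j ∣     ≤⟨ +-monoˡ-≤ ∣ K ─ A j ∣ (once j∈D) ⟩
      suc ∣ K ─ A j ∣               ∎)
      where open ≤-Reasoning

    uncovered′ : ∀ f K D → ∣ D ∣ ≤ f → MeetsOnce K D → ∣ D ∣ < ∣ K ∣ → ∃ λ k → k ∈ K × Avoids k D
    uncovered′ f K D ∣D∣≤f once ∣D∣<∣K∣ with nonempty? D
    ... | no D-empty with k , k∈K ← 0<∣p∣⇒Nonempty (≤-trans (s≤s z≤n) ∣D∣<∣K∣) =
      k , k∈K , λ j∈D → contradiction (_ , j∈D) D-empty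
    uncovered′ zero    K D ∣D∣≤0 once ∣D∣<∣K∣ | yes D-nonempty =
      contradiction ∣D∣≤0 (<⇒≱ (Nonempty⇒0<∣p∣ D-nonempty))
    uncovered′ (suc f) K D ∣D∣≤1+f once ∣D∣<∣K∣ | yes (j , j∈D)
      with k , k∈K─Aⱼ , k-avoids ← uncovered′ f (K ─ A j) (D - j)
             (s≤s⁻¹ (subst (_≤ suc f) (sym (x∈p⇒suc∣p-x∣≡∣p∣ j∈D)) ∣D∣≤1+f))
             (meetsOnce-─ {K} j once) (∣D-j∣<∣K─Aⱼ∣ {K} j∈D once ∣D∣<∣K∣)
      = k , p─q⊆p K (A j) k∈K─Aⱼ , avoids
      where
        avoids : Avoids k D
        avoids {j′} j′∈D with j′ Fin.≟ j
        ... | yes refl = x∈p─q⇒x∉q k∈K─Aⱼ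
        ... | no  j′≢j = k-avoids (x∈p∧x≢y⇒x∈p-y j′∈D j′≢j)

  uncovered : ∀ K D → MeetsOnce K D → ∣ D ∣ < ∣ K ∣ → ∃ λ k → k ∈ K × Avoids k D
  uncovered K D = uncovered′ ∣ D ∣ K D ≤-refl

-- Subfamilies of a list and their sums

select : (L : List A) → Subset (length L) → List A
select []      []          = []
select (x ∷ L) (true ∷ p)  = x ∷ select L p
select (x ∷ L) (false ∷ p) = select L p

length-select : ∀ (L : List A) p → length (select L p) ≡ ∣ p ∣
length-select []      []          = refl
length-select (x ∷ L) (true ∷ p)  = cong suc (length-select L p)
length-select (x ∷ L) (false ∷ p) = length-select L p

select-⊆ : ∀ (L : List A) p → select L p Sublist.⊆ L
select-⊆ []      []          = []
select-⊆ (x ∷ L) (true ∷ p)  = refl ∷ select-⊆ L p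
select-⊆ (x ∷ L) (false ∷ p) = x ∷ʳ select-⊆ L p

select-mono : ∀ (L : List A) {p q} → p ⊆ q → select L p Sublist.⊆ select L q
select-mono []      {[]}        {[]}        p⊆q = []
select-mono (x ∷ L) {true ∷ p}  {true ∷ q}  p⊆q = refl ∷ select-mono L (drop-∷-⊆ p⊆q)
select-mono (x ∷ L) {true ∷ p}  {false ∷ q} p⊆q with () ← p⊆q here
select-mono (x ∷ L) {false ∷ p} {true ∷ q}  p⊆q = x ∷ʳ select-mono L (drop-∷-⊆ p⊆q)
select-mono (x ∷ L) {false ∷ p} {false ∷ q} p⊆q = select-mono L (drop-∷-⊆ p⊆q)

⊆⇒select : ∀ {T L : List A} → T Sublist.⊆ L → ∃ λ p → select L p ≡ T
⊆⇒select []        = [] , refl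
⊆⇒select (x ∷ʳ σ)  with p , refl ← ⊆⇒select σ = false ∷ p , refl
⊆⇒select (refl ∷ σ) with p , refl ← ⊆⇒select σ = true ∷ p , refl

select-select : ∀ (L : List A) p (q : Subset (length (select L p))) →
                ∃ λ r → r ⊆ p × select L r ≡ select (select L p) q
select-select []      []          []          = [] , (λ ()) , refl
select-select (x ∷ L) (false ∷ p) q           with r , r⊆p , eq ← select-select L p q =
  false ∷ r , (λ { (there y∈r) → there (r⊆p y∈r) }) , eq
select-select (x ∷ L) (true ∷ p)  (false ∷ q) with r , r⊆p , eq ← select-select L p q =
  false ∷ r , (λ { (there y∈r) → there (r⊆p y∈r) }) , eq
select-select (x ∷ L) (true ∷ p)  (true ∷ q)  with r , r⊆p , eq ← select-select L p q =
  true ∷ r , (λ { here → here ; (there y∈r) → there (r⊆p y∈r) }) , cong (x ∷_) eq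

lookup∈select : ∀ (L : List A) {p j} → j ∈ p → lookup L j List.∈ select L p
lookup∈select (x ∷ L) {true ∷ p}  here        = here refl
lookup∈select (x ∷ L) {true ∷ p}  (there j∈p) = there (lookup∈select L j∈p)
lookup∈select (x ∷ L) {false ∷ p} (there j∈p) = lookup∈select L j∈p

⨁ : ∀ {k} → (Fin k → Point n) → Subset k → Point n
⨁ f []          = 𝟎
⨁ f (true ∷ p)  = f zero ⊕ ⨁ (f ∘ suc) p
⨁ f (false ∷ p) = ⨁ (f ∘ suc) p

sumP-select : ∀ (L : List (Point n)) p → sumP (select L p) ≡ ⨁ (lookup L) p
sumP-select []      []          = refl
sumP-select (x ∷ L) (true ∷ p)  = cong (x ⊕_) (sumP-select L p)
sumP-select (x ∷ L) (false ∷ p) = sumP-select L p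

⨁-cong : ∀ {k} {f g : Fin k → Point n} → (∀ i → f i ≡ g i) → ∀ p → ⨁ f p ≡ ⨁ g p
⨁-cong f≗g []          = refl
⨁-cong f≗g (true ∷ p)  = cong₂ _⊕_ (f≗g zero) (⨁-cong (f≗g ∘ suc) p)
⨁-cong f≗g (false ∷ p) = ⨁-cong (f≗g ∘ suc) p

⨁-∅ : ∀ {k} (f : Fin k → Point n) → ⨁ f ∅ ≡ 𝟎
⨁-∅ {k = zero}  f = refl
⨁-∅ {k = suc k} f = ⨁-∅ (f ∘ suc)

⨁-⁅⁆ : ∀ {k} (f : Fin k → Point n) i → ⨁ f ⁅ i ⁆ ≡ f i
⨁-⁅⁆ f zero    = trans (cong (f zero ⊕_) (⨁-∅ (f ∘ suc))) (⊕-identityʳ (f zero))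
⨁-⁅⁆ f (suc i) = ⨁-⁅⁆ (f ∘ suc) i

⨁-⊕ : ∀ {k} (f : Fin k → Point n) p q → ⨁ f (p ⊕ q) ≡ ⨁ f p ⊕ ⨁ f q
⨁-⊕ f []          []          = sym (⊕-identityˡ 𝟎)
⨁-⊕ f (false ∷ p) (false ∷ q) = ⨁-⊕ (f ∘ suc) p q
⨁-⊕ f (true ∷ p)  (false ∷ q) =
  trans (cong (f zero ⊕_) (⨁-⊕ (f ∘ suc) p q)) (sym (⊕-assoc (f zero) _ _))
⨁-⊕ {n = n} f (false ∷ p) (true ∷ q)  = begin
  x ⊕ ⨁ (f ∘ suc) (p ⊕ q)   ≡⟨ cong (x ⊕_) (⨁-⊕ (f ∘ suc) p q) ⟩
  x ⊕ (σp ⊕ σq)             ≡⟨ sym (⊕-assoc x σp σq) ⟩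
  (x ⊕ σp) ⊕ σq             ≡⟨ cong (_⊕ σq) (⊕-comm x σp) ⟩
  (σp ⊕ x) ⊕ σq             ≡⟨ ⊕-assoc σp x σq ⟩
  σp ⊕ (x ⊕ σq)             ∎
  where
    open ≡-Reasoning
    x σp σq : Point n
    x  = f zero
    σp = ⨁ (f ∘ suc) p
    σq = ⨁ (f ∘ suc) q
⨁-⊕ {n = n} f (true ∷ p)  (true ∷ q)  = begin
  ⨁ (f ∘ suc) (p ⊕ q)       ≡⟨ ⨁-⊕ (f ∘ suc) p q ⟩
  σp ⊕ σq                   ≡⟨ sym (⊕-identityˡ _) ⟩
  𝟎 ⊕ (σp ⊕ σq)             ≡⟨ cong (_⊕ (σp ⊕ σq)) (sym (⊕-self x)) ⟩
  (x ⊕ x) ⊕ (σp ⊕ σq)       ≡⟨ ⊕-interchange x x σp σq ⟩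
  (x ⊕ σp) ⊕ (x ⊕ σq)       ∎
  where
    open ≡-Reasoning
    x σp σq : Point n
    x  = f zero
    σp = ⨁ (f ∘ suc) p
    σq = ⨁ (f ∘ suc) q

⨁-⊕-𝟎 : ∀ {m} (f : Fin m → Point n) p q → ⨁ f p ≡ 𝟎 → ⨁ f q ≡ 𝟎 → ⨁ f (p ⊕ q) ≡ 𝟎
⨁-⊕-𝟎 f p q ⨁p≡𝟎 ⨁q≡𝟎 = trans (⨁-⊕ f p q) (trans (cong₂ _⊕_ ⨁p≡𝟎 ⨁q≡𝟎) (⊕-self 𝟎))

⨁-⨁ : ∀ {k m} (g : Fin m → Point n) (R : Fin k → Subset m) u →
      ⨁ g (⨁ R u) ≡ ⨁ (⨁ g ∘ R) u
⨁-⨁ g R []          = ⨁-∅ g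
⨁-⨁ g R (true ∷ u)  = trans (⨁-⊕ g (R zero) (⨁ (R ∘ suc) u)) (cong (⨁ g (R zero) ⊕_) (⨁-⨁ g (R ∘ suc) u))
⨁-⨁ g R (false ∷ u) = ⨁-⨁ g (R ∘ suc) u

∣⨁∣%2 : ∀ {k m} (R : Fin k → Subset m) → (∀ i → ∣ R i ∣ % 2 ≡ 1) → ∀ u → ∣ ⨁ R u ∣ % 2 ≡ ∣ u ∣ % 2
∣⨁∣%2 {m = m} R R-odd []          = cong (_% 2) (∣⊥∣≡0 m)
∣⨁∣%2 R R-odd (true ∷ u)  = begin
  ∣ R zero ⊕ ⨁ (R ∘ suc) u ∣ % 2              ≡⟨ ∣p⊕q∣%2 (R zero) (⨁ (R ∘ suc) u) ⟩
  (∣ R zero ∣ + ∣ ⨁ (R ∘ suc) u ∣) % 2        ≡⟨ %2-+ {∣ R zero ∣} {∣ ⨁ (R ∘ suc) u ∣}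
                                                   (R-odd zero) (∣⨁∣%2 (R ∘ suc) (R-odd ∘ suc) u) ⟩
  (1 + ∣ u ∣ % 2) % 2                         ≡⟨ %2-+ {1} {∣ u ∣} refl refl ⟨
  suc ∣ u ∣ % 2                               ∎
  where open ≡-Reasoning
∣⨁∣%2 R R-odd (false ∷ u) = ∣⨁∣%2 (R ∘ suc) (R-odd ∘ suc) u

-- Affine independence and rank

Independent : (L : List (Point n)) → Subset (length L) → Set
Independent L β = ∀ {p} → p ⊆ β → Nonempty p → ∣ p ∣ % 2 ≡ 0 → ⨁ (lookup L) p ≢ 𝟎

InAffSub : (L : List (Point n)) → Subset (length L) → Point n → Set
InAffSub L β x = ∃ λ p → p ⊆ β × ∣ p ∣ % 2 ≡ 1 × ⨁ (lookup L) p ≡ x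

InAffSub? : ∀ (L : List (Point n)) β x → Dec (InAffSub L β x)
InAffSub? L β x =
  anySubset? λ p → p ⊆? β ×-dec ∣ p ∣ % 2 ≟ 1 ×-dec ≡-dec _≟ᵇ_ (⨁ (lookup L) p) x

InAff⇒InAffSub : ∀ {L : List (Point n)} {x} → InAff L x → InAffSub L ⊤ x
InAff⇒InAffSub {L = L} (T , T⊆L , T-odd , ΣT≡x) with p , refl ← ⊆⇒select T⊆L =
  p , ⊆⊤ , subst (λ k → k % 2 ≡ 1) (length-select L p) T-odd , trans (sym (sumP-select L p)) ΣT≡x

InAffSub⇒InAff : ∀ {L : List (Point n)} {β x} → InAffSub L β x → InAff (select L β) x
InAffSub⇒InAff {L = L} (p , p⊆β , p-odd , ⨁p≡x) =
  select L p , select-mono L p⊆β , subst (λ k → k % 2 ≡ 1) (sym (length-select L p)) p-odd ,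
  trans (sumP-select L p) ⨁p≡x

InAff-⊆ : ∀ {T L : List (Point n)} {x} → T Sublist.⊆ L → InAff T x → InAff L x
InAff-⊆ T⊆L (U , U⊆T , U-odd , ΣU≡x) = U , Sublist.⊆-trans U⊆T T⊆L , U-odd , ΣU≡x

InAff-∈ : ∀ {L : List (Point n)} {x} → x List.∈ L → InAff L x
InAff-∈ {x = x} x∈L = x ∷ [] , Sublist.from∈ x∈L , refl , ⊕-identityʳ x

Independent-select : ∀ {L : List (Point n)} {β} → Independent L β → Independent (select L β) ⊤
Independent-select {L = L} {β} indep {q} _ q-nonempty q-even ⨁q≡𝟎
  with r , r⊆β , select-r ← select-select L β q =
  indep r⊆β (0<∣p∣⇒Nonempty (subst (0 <_) (sym ∣r∣≡∣q∣) (Nonempty⇒0<∣p∣ q-nonempty)))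
        (subst (λ k → k % 2 ≡ 0) (sym ∣r∣≡∣q∣) q-even)
        (begin
          ⨁ (lookup L) r                  ≡⟨ sym (sumP-select L r) ⟩
          sumP (select L r)               ≡⟨ cong sumP select-r ⟩
          sumP (select (select L β) q)    ≡⟨ sumP-select (select L β) q ⟩
          ⨁ (lookup (select L β)) q       ≡⟨ ⨁q≡𝟎 ⟩
          𝟎                               ∎)
  where
    open ≡-Reasoning
    ∣r∣≡∣q∣ : ∣ r ∣ ≡ ∣ q ∣
    ∣r∣≡∣q∣ = trans (sym (length-select L r))
                (trans (cong length select-r) (length-select (select L β) q))

private
  splitFirst : ∀ (L : List (Point n)) p → Nonempty p →
    ∃ λ B₁ → ∃ λ x → ∃ λ B₂ → ∃ λ T → L ≡ B₁ ++ x ∷ B₂ × T Sublist.⊆ B₁ ++ B₂ ×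
      suc (length T) ≡ ∣ p ∣ × ⨁ (lookup L) p ≡ x ⊕ sumP T
  splitFirst (x ∷ L) (true ∷ p) _ =
    [] , x , L , select L p , refl , select-⊆ L p , cong suc (length-select L p) ,
    cong (x ⊕_) (sym (sumP-select L p))
  splitFirst (y ∷ L) (false ∷ p) (suc i , there i∈p)
    with B₁ , x , B₂ , T , refl , T⊆ , len , sum ← splitFirst L p (i , i∈p) =
    y ∷ B₁ , x , B₂ , T , refl , y ∷ʳ T⊆ , len , sum

  insert : ∀ B₁ {x B₂} {T : List (Point n)} → T Sublist.⊆ B₁ ++ B₂ →
    ∃ λ p → ∣ p ∣ ≡ suc (length T) × ⨁ (lookup (B₁ ++ x ∷ B₂)) p ≡ x ⊕ sumP T
  insert [] {x} {B₂} T⊆B₂ with p , refl ← ⊆⇒select T⊆B₂ =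
    true ∷ p , cong suc (sym (length-select B₂ p)) , cong (x ⊕_) (sym (sumP-select B₂ p))
  insert (y ∷ B₁) {x} (.y ∷ʳ T⊆) with p , len , sum ← insert B₁ {x} T⊆ = false ∷ p , len , sum
  insert {n} (y ∷ B₁) {x} {B₂} {_ ∷ T} (refl ∷ T⊆) with p , len , sum ← insert B₁ {x} T⊆ =
    true ∷ p , cong suc len , (begin
      y ⊕ ⨁ (lookup (B₁ ++ x ∷ B₂)) p   ≡⟨ cong (y ⊕_) sum ⟩
      y ⊕ (x ⊕ σ)                       ≡⟨ sym (⊕-assoc y x σ) ⟩
      (y ⊕ x) ⊕ σ                       ≡⟨ cong (_⊕ σ) (⊕-comm y x) ⟩
      (x ⊕ y) ⊕ σ                       ≡⟨ ⊕-assoc x y σ ⟩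
      x ⊕ (y ⊕ σ)                       ∎)
    where
      open ≡-Reasoning
      σ : Point n
      σ = sumP T

AffIndep⇒Independent : ∀ {L : List (Point n)} → AffIndep L → Independent L ⊤
AffIndep⇒Independent {L = L} affIndep {p} _ p-nonempty p-even ⨁p≡𝟎
  with B₁ , x , B₂ , T , L≡ , T⊆ , len , sum ← splitFirst L p p-nonempty =
  affIndep B₁ B₂ x L≡
    (T , T⊆ , suc-even⇒odd (length T) (subst (λ k → k % 2 ≡ 0) (sym len) p-even) ,
     sym (⊕≡𝟎⇒≡ (trans (sym sum) ⨁p≡𝟎)))

Independent⇒AffIndep : ∀ {L : List (Point n)} → Independent L ⊤ → AffIndep L
Independent⇒AffIndep indep B₁ B₂ x refl (T , T⊆ , T-odd , ΣT≡x) with p , len , sum ← insert B₁ {x} T⊆ =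
  indep {p} ⊆⊤ (0<∣p∣⇒Nonempty (subst (0 <_) (sym len) (s≤s z≤n)))
    (subst (λ k → k % 2 ≡ 0) (sym len) (odd⇒suc-even (length T) T-odd))
    (trans sum (trans (cong (x ⊕_) ΣT≡x) (⊕-self x)))

private
  bit : Bool → Fin 2
  bit false = zero
  bit true  = suc zero

  bool : Fin 2 → Bool
  bool zero       = false
  bool (suc zero) = true

  bit-injective : ∀ {a b} → bit a ≡ bit b → a ≡ b
  bit-injective {false} {false} _ = refl
  bit-injective {true}  {true}  _ = refl

  bit-bool : ∀ i → bit (bool i) ≡ i
  bit-bool zero       = refl
  bit-bool (suc zero) = refl

  toFin : ∀ {k} → Subset k → Fin (2 ^ k)
  toFin []      = zero
  toFin (b ∷ p) = combine (bit b) (toFin p)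

  fromFin : ∀ {k} → Fin (2 ^ k) → Subset k
  fromFin {zero}  _ = []
  fromFin {suc k} i = bool (quotient (2 ^ k) i) ∷ fromFin (remainder {2} (2 ^ k) i)

  toFin-injective : ∀ {k} {p q : Subset k} → toFin p ≡ toFin q → p ≡ q
  toFin-injective {p = []}    {[]}    _  = refl
  toFin-injective {p = b ∷ p} {c ∷ q} eq
    with b≡c , p≡q ← combine-injective (bit b) (toFin p) (bit c) (toFin q) eq =
    cong₂ _∷_ (bit-injective b≡c) (toFin-injective p≡q)

  toFin-fromFin : ∀ {k} (i : Fin (2 ^ k)) → toFin (fromFin {k} i) ≡ i
  toFin-fromFin {zero}  zero = refl
  toFin-fromFin {suc k} i    =
    trans (cong₂ combine (bit-bool (quotient (2 ^ k) i)) (toFin-fromFin {k} (remainder {2} (2 ^ k) i)))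
          (combine-remQuot {2} (2 ^ k) i)

  fromFin-injective : ∀ {k} {i j : Fin (2 ^ k)} → fromFin {k} i ≡ fromFin {k} j → i ≡ j
  fromFin-injective {k} {i} {j} eq =
    trans (sym (toFin-fromFin {k} i)) (trans (cong toFin eq) (toFin-fromFin {k} j))

-- Two colliding subfamilies differ by an even subfamily of X summing to 𝟎.
⨁-injective : ∀ {X Y : List (Point n)} → Independent X ⊤ →
  (R : Fin (length X) → Subset (length Y)) → (∀ i → ∣ R i ∣ % 2 ≡ 1) →
  (∀ i → ⨁ (lookup Y) (R i) ≡ lookup X i) → ∀ u v → ⨁ R u ≡ ⨁ R v → u ≡ v
⨁-injective {X = X} {Y} indep R R-odd R-sum u v ⨁Ru≡⨁Rv with nonempty? (u ⊕ v)
... | no  u⊕v-empty = ⊕≡𝟎⇒≡ (Empty-unique u⊕v-empty)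
... | yes u⊕v-nonempty = contradiction ⨁X[u⊕v]≡𝟎 (indep ⊆⊤ u⊕v-nonempty u⊕v-even)
  where
    open ≡-Reasoning
    ⨁R[u⊕v]≡𝟎 : ⨁ R (u ⊕ v) ≡ 𝟎
    ⨁R[u⊕v]≡𝟎 = trans (⨁-⊕ R u v) (trans (cong (_⊕ ⨁ R v) ⨁Ru≡⨁Rv) (⊕-self (⨁ R v)))

    u⊕v-even : ∣ u ⊕ v ∣ % 2 ≡ 0
    u⊕v-even = begin
      ∣ u ⊕ v ∣ % 2          ≡⟨ ∣⨁∣%2 R R-odd (u ⊕ v) ⟨
      ∣ ⨁ R (u ⊕ v) ∣ % 2    ≡⟨ cong (λ w → ∣ w ∣ % 2) ⨁R[u⊕v]≡𝟎 ⟩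
      ∣ ∅ {n = length Y} ∣ % 2 ≡⟨ cong (_% 2) (∣⊥∣≡0 (length Y)) ⟩
      0                      ∎

    ⨁X[u⊕v]≡𝟎 : ⨁ (lookup X) (u ⊕ v) ≡ 𝟎
    ⨁X[u⊕v]≡𝟎 = begin
      ⨁ (lookup X) (u ⊕ v)                ≡⟨ ⨁-cong (sym ∘ R-sum) (u ⊕ v) ⟩
      ⨁ (⨁ (lookup Y) ∘ R) (u ⊕ v)        ≡⟨ ⨁-⨁ (lookup Y) R (u ⊕ v) ⟨
      ⨁ (lookup Y) (⨁ R (u ⊕ v))          ≡⟨ cong (⨁ (lookup Y)) ⨁R[u⊕v]≡𝟎 ⟩
      ⨁ (lookup Y) ∅                      ≡⟨ ⨁-∅ (lookup Y) ⟩
      𝟎                                   ∎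

rank : ∀ {X Y : List (Point n)} → Independent X ⊤ → (∀ i → InAffSub Y ⊤ (lookup X i)) →
       length X ≤ length Y
rank {X = X} {Y} indep inAff with length X ≤? length Y
... | yes X≤Y = X≤Y
... | no  X≰Y
  with i , j , i<j , same ← pigeonhole (^-monoʳ-< 2 (s≤s (s≤s z≤n)) (≰⇒> X≰Y))
                                       (toFin ∘ ⨁ (proj₁ ∘ inAff) ∘ fromFin {length X})
  = contradiction (fromFin-injective {length X} subfamiliesᵢ≡ⱼ) (λ i≡j → <-irrefl i≡j i<j)
  where
    subfamiliesᵢ≡ⱼ : fromFin {length X} i ≡ fromFin {length X} j
    subfamiliesᵢ≡ⱼ = ⨁-injective {X = X} {Y} indep (proj₁ ∘ inAff) (proj₁ ∘ proj₂ ∘ proj₂ ∘ inAff)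
                       (proj₂ ∘ proj₂ ∘ proj₂ ∘ inAff) _ _ (toFin-injective same)

-- Bases and their circuits

-- In the paper's notation c = B_j ∪ {j}, where B_j ⊆ β sums to the j-th point.
record Circuit (L : List (Point n)) (β : Subset (length L)) (j : Fin (length L))
               (c : Subset (length L)) : Set where
  field
    j∈c   : j ∈ c
    c⊆β∪j : ∀ {t} → t ∈ c → t ≢ j → t ∈ β
    even  : ∣ c ∣ % 2 ≡ 0
    sum≡𝟎 : ⨁ (lookup L) c ≡ 𝟎

record Basis (L : List (Point n)) : Set where
  field
    members     : Subset (length L)
    independent : Independent L members
    -- only meaningful for j ∉ members; its value at members is arbitrary
    circuit     : Fin (length L) → Subset (length L)
    isCircuit   : ∀ {j} → j ∉ members → Circuit L members j (circuit j)

circuit-∷ : ∀ {L : List (Point n)} {β j c} x b →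
            Circuit L β j c → Circuit (x ∷ L) (b ∷ β) (suc j) (false ∷ c)
circuit-∷ x b circ = record
  { j∈c   = there j∈c
  ; c⊆β∪j = λ { (there t∈c) t≢j → there (c⊆β∪j t∈c (t≢j ∘ cong suc)) }
  ; even  = even
  ; sum≡𝟎 = sum≡𝟎
  }
  where open Circuit circ

module _ {L : List (Point n)} (x : Point n) (b : Basis L) where
  open Basis b renaming (members to β)

  extendDependent : InAffSub L β x → Basis (x ∷ L)
  extendDependent (q , q⊆β , q-odd , ⨁q≡x) = record
    { members = false ∷ β ; independent = indep ; circuit = circ ; isCircuit = isCirc }
    where
      indep : Independent (x ∷ L) (false ∷ β)
      indep {true ∷ p}  p⊆β with () ← p⊆β here
      indep {false ∷ p} p⊆β (suc i , there i∈p) = independent (drop-∷-⊆ p⊆β) (i , i∈p)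

      circ : Fin (suc (length L)) → Subset (suc (length L))
      circ zero    = true ∷ q
      circ (suc j) = false ∷ circuit j

      isCirc : ∀ {j} → j ∉ false ∷ β → Circuit (x ∷ L) (false ∷ β) j (circ j)
      isCirc {zero} _ = record
        { j∈c   = here
        ; c⊆β∪j = λ { here 0≢0 → contradiction refl 0≢0 ; (there t∈q) _ → there (q⊆β t∈q) }
        ; even  = odd⇒suc-even ∣ q ∣ q-odd
        ; sum≡𝟎 = trans (cong (x ⊕_) ⨁q≡x) (⊕-self x)
        }
      isCirc {suc j} j∉β = circuit-∷ x false (isCircuit (j∉β ∘ there))

  extendIndependent : ¬ InAffSub L β x → Basis (x ∷ L)
  extendIndependent x∉aff = record
    { members = true ∷ β ; independent = indep ; circuit = circ ; isCircuit = isCirc }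
    where
      indep : Independent (x ∷ L) (true ∷ β)
      indep {true ∷ p}  p⊆β _ even sum≡𝟎 =
        x∉aff (p , drop-∷-⊆ p⊆β , suc-even⇒odd ∣ p ∣ even , sym (⊕≡𝟎⇒≡ sum≡𝟎))
      indep {false ∷ p} p⊆β (suc i , there i∈p) = independent (drop-∷-⊆ p⊆β) (i , i∈p)

      circ : Fin (suc (length L)) → Subset (suc (length L))
      circ zero    = ∅
      circ (suc j) = false ∷ circuit j

      isCirc : ∀ {j} → j ∉ true ∷ β → Circuit (x ∷ L) (true ∷ β) j (circ j)
      isCirc {zero}  0∉β = contradiction here 0∉β
      isCirc {suc j} j∉β = circuit-∷ x true (isCircuit (j∉β ∘ there))

  extend : Basis (x ∷ L)
  extend with InAffSub? L β x
  ... | yes x∈aff = extendDependent x∈aff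
  ... | no  x∉aff = extendIndependent x∉aff

basis : (L : List (Point n)) → Basis L
basis []      = record
  { members = [] ; independent = λ { _ (() , _) } ; circuit = λ () ; isCircuit = λ { {()} } }
basis (x ∷ L) = extend x (basis L)

module _ {L : List (Point n)} {β j c} (circ : Circuit L β j c) where
  open Circuit circ

  c⊕⁅j⁆⊆β : c ⊕ ⁅ j ⁆ ⊆ β
  c⊕⁅j⁆⊆β {t} t∈ = c⊆β∪j (p─q⊆p c ⁅ j ⁆ t∈c-j) (x∈p-y⇒x≢y t∈c-j)
    where
      t∈c-j : t ∈ c - j
      t∈c-j = subst (t ∈_) (x∈p⇒p⊕⁅x⁆≡p-x j∈c) t∈

  suc∣c⊕⁅j⁆∣≡∣c∣ : suc ∣ c ⊕ ⁅ j ⁆ ∣ ≡ ∣ c ∣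
  suc∣c⊕⁅j⁆∣≡∣c∣ = trans (cong (suc ∘ ∣_∣) (x∈p⇒p⊕⁅x⁆≡p-x j∈c)) (x∈p⇒suc∣p-x∣≡∣p∣ j∈c)

  suc∣c∩β∣≡∣c∣ : j ∉ β → suc ∣ c ∩ β ∣ ≡ ∣ c ∣
  suc∣c∩β∣≡∣c∣ j∉β = trans (cong (suc ∘ ∣_∣) c∩β≡c⊕⁅j⁆) suc∣c⊕⁅j⁆∣≡∣c∣
    where
      c∩β≡c⊕⁅j⁆ : c ∩ β ≡ c ⊕ ⁅ j ⁆
      c∩β≡c⊕⁅j⁆ = ⊆-antisym
        (λ t∈c∩β → let (t∈c , t∈β) = x∈p∩q⁻ c β t∈c∩β in
           x∈p⊕q⁺ (inj₁ (t∈c , λ t∈⁅j⁆ → j∉β (subst (_∈ β) (x∈⁅y⁆⇒x≡y j t∈⁅j⁆) t∈β))))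
        (λ t∈ → x∈p∩q⁺ (p─q⊆p c ⁅ j ⁆ (subst (_ ∈_) (x∈p⇒p⊕⁅x⁆≡p-x j∈c) t∈) , c⊕⁅j⁆⊆β t∈))

module _ {L : List (Point n)} (b : Basis L) where
  open Basis b renaming (members to β)

  private
    circuit-shrinks : ∀ {p j} (j∈p─β : j ∈ p ─ β) →
                      ∣ (p ⊕ circuit j) ─ β ∣ < ∣ p ─ β ∣
    circuit-shrinks {p} {j} j∈p─β =
      subst (∣ (p ⊕ c) ─ β ∣ <_) (x∈p⇒suc∣p-x∣≡∣p∣ j∈p─β) (s≤s (p⊆q⇒∣p∣≤∣q∣ p⊕c─β⊆p─β-j))
      where
        c : Subset (length L)
        c = circuit j
        open Circuit (isCircuit (x∈p─q⇒x∉q j∈p─β))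

        p⊕c─β⊆p─β-j : (p ⊕ c) ─ β ⊆ (p ─ β) - j
        p⊕c─β⊆p─β-j {t} t∈ with x∈p⊕q⁻ p c (p─q⊆p _ β t∈)
        ... | inj₁ (t∈p , t∉c) =
          x∈p∧x≢y⇒x∈p-y (x∈p∧x∉q⇒x∈p─q t∈p (x∈p─q⇒x∉q t∈)) λ { refl → t∉c j∈c }
        ... | inj₂ (t∉p , t∈c) with t Fin.≟ j
        ...   | yes refl = contradiction (p─q⊆p p β j∈p─β) t∉p
        ...   | no  t≢j  = contradiction (c⊆β∪j t∈c t≢j) (x∈p─q⇒x∉q t∈)

    reduce : ∀ f p → ∣ p ─ β ∣ ≤ f →
             ∃ λ q → q ⊆ β × ∣ q ∣ % 2 ≡ ∣ p ∣ % 2 × ⨁ (lookup L) q ≡ ⨁ (lookup L) p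
    reduce f p ∣p─β∣≤f with nonempty? (p ─ β)
    ... | no p─β-empty = p , p⊆β , refl , refl
      where
        p⊆β : p ⊆ β
        p⊆β {t} t∈p with t ∈? β
        ... | yes t∈β = t∈β
        ... | no  t∉β = contradiction (t , x∈p∧x∉q⇒x∈p─q t∈p t∉β) p─β-empty
    reduce zero    p ∣p─β∣≤0 | yes p─β-nonempty =
      contradiction ∣p─β∣≤0 (<⇒≱ (Nonempty⇒0<∣p∣ p─β-nonempty))
    reduce (suc f) p ∣p─β∣≤1+f | yes (j , j∈p─β)
      with q , q⊆β , q%2 , ⨁q ← reduce f (p ⊕ circuit j)
                                 (s≤s⁻¹ (≤-trans (circuit-shrinks j∈p─β) ∣p─β∣≤1+f))
      = q , q⊆β , trans q%2 (trans (∣p⊕q∣%2 p c) (+-even-%2 ∣ p ∣ even)) ,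
        trans ⨁q (trans (⨁-⊕ (lookup L) p c) (trans (cong (_ ⊕_) sum≡𝟎) (⊕-identityʳ _)))
      where
        c : Subset (length L)
        c = circuit j
        open Circuit (isCircuit (x∈p─q⇒x∉q j∈p─β))

  spans : ∀ {x} → InAffSub L ⊤ x → InAffSub L β x
  spans (p , _ , p-odd , ⨁p≡x) with q , q⊆β , q%2 , ⨁q ← reduce ∣ p ─ β ∣ p ≤-refl =
    q , q⊆β , trans q%2 p-odd , trans ⨁q ⨁p≡x

  isBasis : IsBasis (select L β) L
  isBasis = select-⊆ L β , Independent⇒AffIndep (Independent-select {L = L} independent) , sameAff
    where
      sameAff : SameAff (select L β) L
      sameAff x = InAff-⊆ (select-⊆ L β) , InAffSub⇒InAff {L = L} ∘ spans ∘ InAff⇒InAffSub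

  ∣members∣≡d+1 : ∀ {d} → HasDim L d → ∣ β ∣ ≡ d + 1
  ∣members∣≡d+1 (P , _ , ∣P∣≡d+1 , P-indep , P≈L) =
    trans (sym (length-select L β)) (trans (≤-antisym B≤P P≤B) ∣P∣≡d+1)
    where
      B≤P : length (select L β) ≤ length P
      B≤P = rank {X = select L β} {P} (Independent-select {L = L} independent) λ i →
        InAff⇒InAffSub (proj₂ (P≈L _) (InAff-⊆ (select-⊆ L β) (InAff-∈ (∈-lookup i))))

      P≤B : length P ≤ length (select L β)
      P≤B = rank {X = P} {select L β} (AffIndep⇒Independent P-indep) λ i →
        InAff⇒InAffSub (InAffSub⇒InAff {L = L} (spans (InAff⇒InAffSub
          (proj₁ (P≈L _) (InAff-∈ (∈-lookup i))))))

hasType5555 : ∀ {L : List (Point n)} (b : Basis L) → ∣ Basis.members b ∣ + 4 ≡ length L →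
              (∀ {j} → j ∉ Basis.members b → ∣ Basis.circuit b j ∣ ≡ 6) →
              HasType5555 (select L (Basis.members b)) L
hasType5555 {L = L} b ∣β∣+4≡∣L∣ ∣c∣≡6 =
  trans (cong (_+ 4) (length-select L β)) ∣β∣+4≡∣L∣ , Bx
  where
    open Basis b renaming (members to β; circuit to c)

    Bx : ∀ x → x List.∈ L → ¬ x List.∈ select L β →
         ∃ λ T → T Sublist.⊆ select L β × sumP T ≡ x × length T ≡ 5
    Bx x x∈L x∉B with Any.index x∈L ∈? β
    ... | yes j∈β =
      contradiction (subst (List._∈ select L β) (sym (lookup-index x∈L)) (lookup∈select L j∈β)) x∉B
    ... | no  j∉β =
      select L (c j ⊕ ⁅ j ⁆) , select-mono L (c⊕⁅j⁆⊆β Cⱼ) , sum≡x ,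
      trans (length-select L (c j ⊕ ⁅ j ⁆)) (suc-injective (trans (suc∣c⊕⁅j⁆∣≡∣c∣ Cⱼ) (∣c∣≡6 j∉β)))
      where
        j : Fin (length L)
        j = Any.index x∈L
        Cⱼ : Circuit L β j (c j)
        Cⱼ = isCircuit j∉β
        open ≡-Reasoning
        sum≡x : sumP (select L (c j ⊕ ⁅ j ⁆)) ≡ x
        sum≡x = begin
          sumP (select L (c j ⊕ ⁅ j ⁆))                ≡⟨ sumP-select L (c j ⊕ ⁅ j ⁆) ⟩
          ⨁ (lookup L) (c j ⊕ ⁅ j ⁆)                    ≡⟨ ⨁-⊕ (lookup L) (c j) ⁅ j ⁆ ⟩
          ⨁ (lookup L) (c j) ⊕ ⨁ (lookup L) ⁅ j ⁆       ≡⟨ cong₂ _⊕_ (Circuit.sum≡𝟎 Cⱼ) (⨁-⁅⁆ (lookup L) j) ⟩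
          𝟎 ⊕ lookup L j                                ≡⟨ ⊕-identityˡ (lookup L j) ⟩
          lookup L j                                    ≡⟨ lookup-index x∈L ⟨
          x                                             ∎

module Exchange {L : List (Point n)} (b : Basis L) {i k : Fin (length L)}
                (i∉β : i ∉ Basis.members b) (k∈β : k ∈ Basis.members b)
                (k∈cᵢ : k ∈ Basis.circuit b i) where
  open Basis b renaming (members to β; circuit to c)
  private
    module Cᵢ = Circuit (isCircuit i∉β)

  β′ : Subset (length L)
  β′ = (β ∪ ⁅ i ⁆) - k

  private
    i≢k : i ≢ k
    i≢k refl = i∉β k∈β

    i∈β′ : i ∈ β′
    i∈β′ = x∈p∧x≢y⇒x∈p-y (x∈p∪q⁺ (inj₂ (x∈⁅x⁆ i))) i≢k

    k∉β′ : k ∉ β′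
    k∉β′ k∈β′ = x∈p-y⇒x≢y k∈β′ refl

    β-k⊆β′ : ∀ {t} → t ∈ β → t ≢ k → t ∈ β′
    β-k⊆β′ t∈β t≢k = x∈p∧x≢y⇒x∈p-y (x∈p∪q⁺ (inj₁ t∈β)) t≢k

    β′-i⊆β : ∀ {t} → t ∈ β′ → t ≢ i → t ∈ β
    β′-i⊆β t∈β′ t≢i with x∈p∪q⁻ β ⁅ i ⁆ (p─q⊆p _ _ t∈β′)
    ... | inj₁ t∈β    = t∈β
    ... | inj₂ t∈⁅i⁆ = contradiction (x∈⁅y⁆⇒x≡y i t∈⁅i⁆) t≢i

    ∉β′⇒∉β : ∀ {j} → j ∉ β′ → j ≢ k → j ∉ β
    ∉β′⇒∉β j∉β′ j≢k j∈β = j∉β′ (β-k⊆β′ j∈β j≢k)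

    ∉β′⇒≢i : ∀ {j} → j ∉ β′ → j ≢ i
    ∉β′⇒≢i j∉β′ refl = j∉β′ i∈β′

    cᵢ-k⊆β′ : ∀ {t} → t ∈ c i → t ≢ k → t ∈ β′
    cᵢ-k⊆β′ {t} t∈cᵢ t≢k with t Fin.≟ i
    ... | yes refl = i∈β′
    ... | no  t≢i  = β-k⊆β′ (Cᵢ.c⊆β∪j t∈cᵢ t≢i) t≢k

  ∣β′∣≡∣β∣ : ∣ β′ ∣ ≡ ∣ β ∣
  ∣β′∣≡∣β∣ = suc-injective (trans (x∈p⇒suc∣p-x∣≡∣p∣ (x∈p∪q⁺ (inj₁ k∈β))) (x∉p⇒∣p∪⁅x⁆∣≡suc∣p∣ i∉β))

  -- A zero sum inside β′ that uses i becomes one inside β after adding the circuit of i.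
  independent′ : Independent L β′
  independent′ {N} N⊆β′ N-nonempty N-even ⨁N≡𝟎 with i ∈? N
  ... | no  i∉N = independent (λ t∈N → β′-i⊆β (N⊆β′ t∈N) λ { refl → i∉N t∈N })
                              N-nonempty N-even ⨁N≡𝟎
  ... | yes i∈N = independent N⊕cᵢ⊆β (k , x∈p⊕q⁺ (inj₂ (k∉β′ ∘ N⊆β′ , k∈cᵢ)))
                              (⊕-even N (c i) N-even Cᵢ.even) (⨁-⊕-𝟎 (lookup L) N (c i) ⨁N≡𝟎 Cᵢ.sum≡𝟎)
    where
      N⊕cᵢ⊆β : N ⊕ c i ⊆ β
      N⊕cᵢ⊆β t∈ with x∈p⊕q⁻ N (c i) t∈
      ... | inj₁ (t∈N , t∉cᵢ) = β′-i⊆β (N⊆β′ t∈N) λ { refl → t∉cᵢ Cᵢ.j∈c }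
      ... | inj₂ (t∉N , t∈cᵢ) = Cᵢ.c⊆β∪j t∈cᵢ λ { refl → t∉N i∈N }

  c′ : Fin (length L) → Subset (length L)
  c′ j with j Fin.≟ k
  ... | yes _ = c i
  ... | no  _ with k ∈? c j
  ...   | yes _ = c j ⊕ c i
  ...   | no  _ = c j

  private
    circuit′-k : Circuit L β′ k (c i)
    circuit′-k = record { j∈c = k∈cᵢ ; c⊆β∪j = cᵢ-k⊆β′ ; even = Cᵢ.even ; sum≡𝟎 = Cᵢ.sum≡𝟎 }

    circuit′-⊕ : ∀ {j} → j ∉ β → j ≢ i → k ∈ c j → Circuit L β′ j (c j ⊕ c i)
    circuit′-⊕ {j} j∉β j≢i k∈cⱼ = record
      { j∈c   = x∈p⊕q⁺ (inj₁ (Cⱼ.j∈c , λ j∈cᵢ → j∉β (Cᵢ.c⊆β∪j j∈cᵢ j≢i)))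
      ; c⊆β∪j = c⊆β∪j
      ; even  = ⊕-even (c j) (c i) Cⱼ.even Cᵢ.even
      ; sum≡𝟎 = ⨁-⊕-𝟎 (lookup L) (c j) (c i) Cⱼ.sum≡𝟎 Cᵢ.sum≡𝟎
      }
      where
        module Cⱼ = Circuit (isCircuit j∉β)
        c⊆β∪j : ∀ {t} → t ∈ c j ⊕ c i → t ≢ j → t ∈ β′
        c⊆β∪j {t} t∈ t≢j with x∈p⊕q⁻ (c j) (c i) t∈
        ... | inj₁ (t∈cⱼ , t∉cᵢ) = β-k⊆β′ (Cⱼ.c⊆β∪j t∈cⱼ t≢j) λ { refl → t∉cᵢ k∈cᵢ }
        ... | inj₂ (t∉cⱼ , t∈cᵢ) = cᵢ-k⊆β′ t∈cᵢ λ { refl → t∉cⱼ k∈cⱼ }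

    circuit′-keep : ∀ {j} → j ∉ β → k ∉ c j → Circuit L β′ j (c j)
    circuit′-keep {j} j∉β k∉cⱼ = record
      { j∈c = j∈c ; c⊆β∪j = λ t∈cⱼ t≢j → β-k⊆β′ (c⊆β∪j t∈cⱼ t≢j) λ { refl → k∉cⱼ t∈cⱼ }
      ; even = even ; sum≡𝟎 = sum≡𝟎 }
      where open Circuit (isCircuit j∉β)

  isCircuit′ : ∀ {j} → j ∉ β′ → Circuit L β′ j (c′ j)
  isCircuit′ {j} j∉β′ with j Fin.≟ k
  ... | yes refl = circuit′-k
  ... | no  j≢k with k ∈? c j
  ...   | yes k∈cⱼ = circuit′-⊕ (∉β′⇒∉β j∉β′ j≢k) (∉β′⇒≢i j∉β′) k∈cⱼ
  ...   | no  k∉cⱼ = circuit′-keep (∉β′⇒∉β j∉β′ j≢k) k∉cⱼ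

  basis′ : Basis L
  basis′ = record { members = β′ ; independent = independent′ ; circuit = c′ ; isCircuit = isCircuit′ }

  ∣c′∣ : ∀ {s} → ∣ c i ∣ ≡ s →
         (∀ {j} → j ∉ β → j ≢ i → k ∈ c j → ∣ c j ⊕ c i ∣ ≡ s) →
         (∀ {j} → j ∉ β → j ≢ i → k ∉ c j → ∣ c j ∣ ≡ s) →
         ∀ {j} → j ∉ β′ → ∣ c′ j ∣ ≡ s
  ∣c′∣ ∣cᵢ∣≡s ∣cⱼ⊕cᵢ∣≡s ∣cⱼ∣≡s {j} j∉β′ with j Fin.≟ k
  ... | yes refl = ∣cᵢ∣≡s
  ... | no  j≢k with k ∈? c j
  ...   | yes k∈cⱼ = ∣cⱼ⊕cᵢ∣≡s (∉β′⇒∉β j∉β′ j≢k) (∉β′⇒≢i j∉β′) k∈cⱼ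
  ...   | no  k∉cⱼ = ∣cⱼ∣≡s (∉β′⇒∉β j∉β′ j≢k) (∉β′⇒≢i j∉β′) k∉cⱼ

-- Caps

Girth≥6 : List (Point n) → Set
Girth≥6 L = ∀ {p} → Nonempty p → ∣ p ∣ % 2 ≡ 0 → ⨁ (lookup L) p ≡ 𝟎 → 6 ≤ ∣ p ∣

pair-sum≢𝟎 : ∀ {L T : List (Point n)} → Unique L → T Sublist.⊆ L → length T ≡ 2 → sumP T ≢ 𝟎
pair-sum≢𝟎 (_ ∷ uniq)   (_ ∷ʳ σ)   len = pair-sum≢𝟎 uniq σ len
pair-sum≢𝟎 {T = x ∷ y ∷ []} (x≢ ∷ _) (refl ∷ σ) _ x⊕y⊕𝟎≡𝟎 =
  All.lookup x≢ (Sublist.to∈ σ) (⊕≡𝟎⇒≡ (trans (cong (x ⊕_) (sym (⊕-identityʳ y))) x⊕y⊕𝟎≡𝟎))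

cap⇒girth≥6 : ∀ {L : List (Point n)} → Unique L → IsCap L → Girth≥6 L
cap⇒girth≥6 {L = L} uniq cap {p} p-nonempty p-even ⨁p≡𝟎 = six≤ ∣ p ∣ refl p-even
  where
    sum≡𝟎 : sumP (select L p) ≡ 𝟎
    sum≡𝟎 = trans (sumP-select L p) ⨁p≡𝟎

    six≤ : ∀ k → ∣ p ∣ ≡ k → k % 2 ≡ 0 → 6 ≤ k
    six≤ 0 ∣p∣≡0 _ = contradiction (subst (0 <_) ∣p∣≡0 (Nonempty⇒0<∣p∣ p-nonempty)) λ ()
    six≤ 2 ∣p∣≡2 _ = contradiction sum≡𝟎
      (pair-sum≢𝟎 uniq (select-⊆ L p) (trans (length-select L p) ∣p∣≡2))
    six≤ 4 ∣p∣≡4 _ = contradiction sum≡𝟎 (cap (select L p) (select-⊆ L p) (trans (length-select L p) ∣p∣≡4))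
    six≤ (suc (suc (suc (suc (suc (suc k)))))) _ _ = s≤s (s≤s (s≤s (s≤s (s≤s (s≤s z≤n)))))

-- Twelve points of girth six with a basis of eight

private
  six-or-eight : ∀ {x} → 6 ≤ x → x ≤ 9 → x % 2 ≡ 0 → x ≡ 6 ⊎ x ≡ 8
  six-or-eight {6} _ _ _ = inj₁ refl
  six-or-eight {8} _ _ _ = inj₂ refl
  six-or-eight {2} (s≤s (s≤s ()))
  six-or-eight {4} (s≤s (s≤s (s≤s (s≤s ()))))
  six-or-eight {suc (suc (suc (suc (suc (suc (suc (suc (suc (suc _)))))))))} _
    (s≤s (s≤s (s≤s (s≤s (s≤s (s≤s (s≤s (s≤s (s≤s ())))))))))

  overlap≤ : ∀ {s t} k → s + 2 * t ≡ 6 + 2 * k → 6 ≤ s → t ≤ k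
  overlap≤ {s} {t} k eq 6≤s =
    *-cancelˡ-≤ 2 (+-cancelˡ-≤ 6 (2 * t) (2 * k) (subst (6 + 2 * t ≤_) eq (+-monoˡ-≤ (2 * t) 6≤s)))

SixCircuitBasis : List (Point n) → Set
SixCircuitBasis L =
  ∃ λ (b : Basis L) → ∣ Basis.members b ∣ ≡ 8 × (∀ {j} → j ∉ Basis.members b → ∣ Basis.circuit b j ∣ ≡ 6)

module Core {L : List (Point n)} (∣L∣≡12 : length L ≡ 12) (girth : Girth≥6 L)
            (b : Basis L) (∣β∣≡8 : ∣ Basis.members b ∣ ≡ 8) where
  open Basis b renaming (members to β; circuit to c)

  private
    module C {j} (j∉β : j ∉ β) = Circuit (isCircuit j∉β)

  ∣∁β∣≡4 : ∣ ∁ β ∣ ≡ 4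
  ∣∁β∣≡4 = trans (∣∁p∣≡n∸∣p∣ β) (cong₂ _∸_ ∣L∣≡12 ∣β∣≡8)

  ∣c∣≡6⊎8 : ∀ {j} → j ∉ β → ∣ c j ∣ ≡ 6 ⊎ ∣ c j ∣ ≡ 8
  ∣c∣≡6⊎8 {j} j∉β = six-or-eight (girth (j , C.j∈c j∉β) (C.even j∉β) (C.sum≡𝟎 j∉β)) (begin
    ∣ c j ∣             ≡⟨ suc∣c∩β∣≡∣c∣ (isCircuit j∉β) j∉β ⟨
    suc ∣ c j ∩ β ∣     ≤⟨ s≤s (∣p∩q∣≤∣q∣ (c j) β) ⟩
    suc ∣ β ∣           ≡⟨ cong suc ∣β∣≡8 ⟩
    9                   ∎) (C.even j∉β)
    where open ≤-Reasoning

  module Pair {j j′} (j∉β : j ∉ β) (j′∉β : j′ ∉ β) (j≢j′ : j ≢ j′) where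
    t : ℕ
    t = ∣ c j ∩ c j′ ∣

    ∣c⊕c′∣+2t≡a+b : ∀ {a b} → ∣ c j ∣ ≡ a → ∣ c j′ ∣ ≡ b → ∣ c j ⊕ c j′ ∣ + 2 * t ≡ a + b
    ∣c⊕c′∣+2t≡a+b ∣c∣≡a ∣c′∣≡b = trans (∣p⊕q∣+2∣p∩q∣≡∣p∣+∣q∣ (c j) (c j′)) (cong₂ _+_ ∣c∣≡a ∣c′∣≡b)

    6≤∣c⊕c′∣ : 6 ≤ ∣ c j ⊕ c j′ ∣
    6≤∣c⊕c′∣ = girth (j , x∈p⊕q⁺ (inj₁ (C.j∈c j∉β , j∉c′)))
                     (⊕-even (c j) (c j′) (C.even j∉β) (C.even j′∉β))
                     (⨁-⊕-𝟎 (lookup L) (c j) (c j′) (C.sum≡𝟎 j∉β) (C.sum≡𝟎 j′∉β))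
      where
        j∉c′ : j ∉ c j′
        j∉c′ j∈c′ = j∉β (C.c⊆β∪j j′∉β j∈c′ j≢j′)

    -- Both circuits lie in β apart from j and j′, and β has 8 elements.
    a+b≤10+t : ∀ {a b} → ∣ c j ∣ ≡ a → ∣ c j′ ∣ ≡ b → a + b ≤ 10 + t
    a+b≤10+t refl refl = begin
      ∣ c j ∣ + ∣ c j′ ∣                      ≡⟨ cong₂ _+_ (suc∣c∩β∣≡∣c∣ (isCircuit j∉β) j∉β)
                                                            (suc∣c∩β∣≡∣c∣ (isCircuit j′∉β) j′∉β) ⟨
      suc ∣ cβ ∣ + suc ∣ c′β ∣                 ≡⟨ cong suc (+-suc ∣ cβ ∣ ∣ c′β ∣) ⟩
      2 + (∣ cβ ∣ + ∣ c′β ∣)                   ≡⟨ cong (2 +_) (∣p∪q∣+∣p∩q∣≡∣p∣+∣q∣ cβ c′β) ⟨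
      2 + (∣ cβ ∪ c′β ∣ + ∣ cβ ∩ c′β ∣)        ≤⟨ +-mono-≤ {2} ≤-refl (+-mono-≤ ∣cβ∪c′β∣≤8 ∣cβ∩c′β∣≤t) ⟩
      2 + (8 + t)                              ∎
      where
        open ≤-Reasoning
        cβ c′β : Subset (length L)
        cβ  = c j ∩ β
        c′β = c j′ ∩ β
        ∣cβ∪c′β∣≤8 : ∣ cβ ∪ c′β ∣ ≤ 8
        ∣cβ∪c′β∣≤8 = ≤-trans (p⊆q⇒∣p∣≤∣q∣ λ {x} x∈ → [ (λ x∈cβ → proj₂ (x∈p∩q⁻ (c j) β x∈cβ))
                                                       , (λ x∈c′β → proj₂ (x∈p∩q⁻ (c j′) β x∈c′β)) ]
                                                       (x∈p∪q⁻ cβ c′β x∈))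
                             (≤-reflexive ∣β∣≡8)
        ∣cβ∩c′β∣≤t : ∣ cβ ∩ c′β ∣ ≤ t
        ∣cβ∩c′β∣≤t = p⊆q⇒∣p∣≤∣q∣ λ x∈ → let (x∈cβ , x∈c′β) = x∈p∩q⁻ cβ c′β x∈ in
          x∈p∩q⁺ (proj₁ (x∈p∩q⁻ (c j) β x∈cβ) , proj₁ (x∈p∩q⁻ (c j′) β x∈c′β))

  module Heavy {j₀} (j₀∉β : j₀ ∉ β) (∣c₀∣≡8 : ∣ c j₀ ∣ ≡ 8) where
    c₀ : Subset (length L)
    c₀ = c j₀

    ∣∁β-j₀∣≡3 : ∣ ∁ β - j₀ ∣ ≡ 3
    ∣∁β-j₀∣≡3 = suc-injective (trans (x∈p⇒suc∣p-x∣≡∣p∣ (x∉p⇒x∈∁p j₀∉β)) ∣∁β∣≡4)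

    ∣c∣≡6 : ∀ {j} → j ∉ β → j ≢ j₀ → ∣ c j ∣ ≡ 6
    ∣c∣≡6 {j} j∉β j≢j₀ with ∣c∣≡6⊎8 j∉β
    ... | inj₁ ∣c∣≡6 = ∣c∣≡6
    ... | inj₂ ∣c∣≡8 = contradiction (overlap≤ 5 (∣c⊕c′∣+2t≡a+b ∣c∣≡8 ∣c₀∣≡8) 6≤∣c⊕c′∣)
                                     (<⇒≱ (+-cancelˡ-≤ 10 6 t (a+b≤10+t ∣c∣≡8 ∣c₀∣≡8)))
      where open Pair j∉β j₀∉β j≢j₀

    module _ {i} (i∉β : i ∉ β) (i≢j₀ : i ≢ j₀) where
      open Pair j₀∉β i∉β (i≢j₀ ∘ sym)

      ∣c₀∩cᵢ∣≡4 : ∣ c₀ ∩ c i ∣ ≡ 4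
      ∣c₀∩cᵢ∣≡4 = ≤-antisym (overlap≤ 4 (∣c⊕c′∣+2t≡a+b ∣c₀∣≡8 (∣c∣≡6 i∉β i≢j₀)) 6≤∣c⊕c′∣)
                            (+-cancelˡ-≤ 10 4 t (a+b≤10+t ∣c₀∣≡8 (∣c∣≡6 i∉β i≢j₀)))

      ∣c₀⊕cᵢ∣≡6 : ∣ c₀ ⊕ c i ∣ ≡ 6
      ∣c₀⊕cᵢ∣≡6 = +-cancelʳ-≡ 8 _ 6 (trans (cong (λ u → ∣ c₀ ⊕ c i ∣ + 2 * u) (sym ∣c₀∩cᵢ∣≡4))
                                       (∣c⊕c′∣+2t≡a+b ∣c₀∣≡8 (∣c∣≡6 i∉β i≢j₀)))

    ∣β─c₀∣≡1 : ∣ β ─ c₀ ∣ ≡ 1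
    ∣β─c₀∣≡1 = +-cancelˡ-≡ 7 _ 1 (begin
      7 + ∣ β ─ c₀ ∣               ≡⟨ cong (_+ ∣ β ─ c₀ ∣) ∣c₀∩β∣≡7 ⟨
      ∣ c₀ ∩ β ∣ + ∣ β ─ c₀ ∣      ≡⟨ cong (λ u → ∣ u ∣ + ∣ β ─ c₀ ∣) (∩-comm c₀ β) ⟩
      ∣ β ∩ c₀ ∣ + ∣ β ─ c₀ ∣      ≡⟨ ∣p∣≡∣p∩q∣+∣p─q∣ β c₀ ⟨
      ∣ β ∣                        ≡⟨ ∣β∣≡8 ⟩
      8                            ∎)
      where
        open ≡-Reasoning
        ∣c₀∩β∣≡7 : ∣ c₀ ∩ β ∣ ≡ 7
        ∣c₀∩β∣≡7 = suc-injective (trans (suc∣c∩β∣≡∣c∣ (isCircuit j₀∉β) j₀∉β) ∣c₀∣≡8)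

    β─c₀-nonempty : Nonempty (β ─ c₀)
    β─c₀-nonempty = 0<∣p∣⇒Nonempty (subst (0 <_) (sym ∣β─c₀∣≡1) (s≤s z≤n))

    z : Fin (length L)
    z = proj₁ β─c₀-nonempty

    z∈β─c₀ : z ∈ β ─ c₀
    z∈β─c₀ = proj₂ β─c₀-nonempty

    z∉c₀ : z ∉ c₀
    z∉c₀ = x∈p─q⇒x∉q z∈β─c₀

    -- Otherwise the five points of c j in β would lie in c₀, which meets c j in only four.
    z∈c : ∀ {j} → j ∉ β → j ≢ j₀ → z ∈ c j
    z∈c {j} j∉β j≢j₀ with z ∈? c j
    ... | yes z∈c = z∈c
    ... | no  z∉c = contradiction (begin
      5                 ≡⟨ suc-injective (trans (suc∣c∩β∣≡∣c∣ (isCircuit j∉β) j∉β) (∣c∣≡6 j∉β j≢j₀)) ⟨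
      ∣ c j ∩ β ∣       ≤⟨ p⊆q⇒∣p∣≤∣q∣ c∩β⊆c₀∩c ⟩
      ∣ c₀ ∩ c j ∣      ≡⟨ ∣c₀∩cᵢ∣≡4 j∉β j≢j₀ ⟩
      4                 ∎) (m+1+n≰m 4)
      where
        open ≤-Reasoning
        c∩β⊆c₀∩c : c j ∩ β ⊆ c₀ ∩ c j
        c∩β⊆c₀∩c {t} t∈ with x∈p∩q⁻ (c j) β t∈ | t ∈? c₀
        ... | t∈c , _   | yes t∈c₀ = x∈p∩q⁺ (t∈c₀ , t∈c)
        ... | t∈c , t∈β | no  t∉c₀ =
          contradiction (subst (_∈ c j) (∣p∣≡1⇒≡ ∣β─c₀∣≡1 (x∈p∧x∉q⇒x∈p─q t∈β t∉c₀) z∈β─c₀) t∈c) z∉c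

    module _ {i j} (i∉β : i ∉ β) (i≢j₀ : i ≢ j₀) (j∉β : j ∉ β) (j≢j₀ : j ≢ j₀) (j≢i : j ≢ i) where
      open Pair j∉β i∉β j≢i

      suc∣c₀∩cᵢ∩c∣≤t : suc ∣ (c₀ ∩ c i) ∩ c j ∣ ≤ t
      suc∣c₀∩cᵢ∩c∣≤t =
        subst (suc ∣ (c₀ ∩ c i) ∩ c j ∣ ≤_) (x∈p⇒suc∣p-x∣≡∣p∣ z∈c∩cᵢ) (s≤s (p⊆q⇒∣p∣≤∣q∣ ⊆c∩cᵢ-z))
        where
          z∈c∩cᵢ : z ∈ c j ∩ c i
          z∈c∩cᵢ = x∈p∩q⁺ (z∈c j∉β j≢j₀ , z∈c i∉β i≢j₀)
          ⊆c∩cᵢ-z : (c₀ ∩ c i) ∩ c j ⊆ (c j ∩ c i) - z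
          ⊆c∩cᵢ-z t∈ with t∈c₀∩cᵢ , t∈c ← x∈p∩q⁻ (c₀ ∩ c i) (c j) t∈
                     with t∈c₀ , t∈cᵢ ← x∈p∩q⁻ c₀ (c i) t∈c₀∩cᵢ =
            x∈p∧x≢y⇒x∈p-y (x∈p∩q⁺ (t∈c , t∈cᵢ)) λ { refl → z∉c₀ t∈c₀ }

      t≤3 : t ≤ 3
      t≤3 = overlap≤ 3 (∣c⊕c′∣+2t≡a+b (∣c∣≡6 j∉β j≢j₀) (∣c∣≡6 i∉β i≢j₀)) 6≤∣c⊕c′∣

      t≡3⇒∣c⊕cᵢ∣≡6 : t ≡ 3 → ∣ c j ⊕ c i ∣ ≡ 6
      t≡3⇒∣c⊕cᵢ∣≡6 t≡3 = +-cancelʳ-≡ 6 _ 6 (trans (cong (λ u → ∣ c j ⊕ c i ∣ + 2 * u) (sym t≡3))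
                                                  (∣c⊕c′∣+2t≡a+b (∣c∣≡6 j∉β j≢j₀) (∣c∣≡6 i∉β i≢j₀)))

    module _ {i} (i∉β : i ∉ β) (i≢j₀ : i ≢ j₀) where
      K : Subset (length L)
      K = c₀ ∩ c i

      D : Subset (length L)
      D = (∁ β - j₀) - i

      -- k has to avoid the circuits meeting c i in fewer than three points; as z ∉ K lies in
      -- all of these intersections, each of them meets K at most once.
      private
        hitsBy : ∀ {j} → Dec (∣ c j ∩ c i ∣ ≡ 3) → Subset (length L)
        hitsBy         (yes _) = ∅
        hitsBy {j = j} (no  _) = c j

        hits : Fin (length L) → Subset (length L)
        hits j = hitsBy (∣ c j ∩ c i ∣ ≟ 3)

        ∈D⇒ : ∀ {j} → j ∈ D → j ∉ β × j ≢ j₀ × j ≢ i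
        ∈D⇒ j∈D = let j∈∁β-j₀ = p─q⊆p _ _ j∈D in
          x∈∁p⇒x∉p (p─q⊆p _ _ j∈∁β-j₀) , x∈p-y⇒x≢y j∈∁β-j₀ , x∈p-y⇒x≢y j∈D

        ∣K∩hitsBy∣≤1 : ∀ {j} → j ∈ D → (d : Dec (∣ c j ∩ c i ∣ ≡ 3)) → ∣ K ∩ hitsBy d ∣ ≤ 1
        ∣K∩hitsBy∣≤1 _   (yes _)   =
          ≤-trans (≤-reflexive (trans (cong ∣_∣ (∩-zeroʳ K)) (∣⊥∣≡0 (length L)))) z≤n
        ∣K∩hitsBy∣≤1 j∈D (no  t≢3) with j∉β , j≢j₀ , j≢i ← ∈D⇒ j∈D =
          s≤s⁻¹ (≤-trans (suc∣c₀∩cᵢ∩c∣≤t i∉β i≢j₀ j∉β j≢j₀ j≢i)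
                         (s≤s⁻¹ (≤∧≢⇒< (t≤3 i∉β i≢j₀ j∉β j≢j₀ j≢i) t≢3)))

        avoidBy⇒three : ∀ {j k} (d : Dec (∣ c j ∩ c i ∣ ≡ 3)) → k ∉ hitsBy d → k ∈ c j → ∣ c j ∩ c i ∣ ≡ 3
        avoidBy⇒three (yes t≡3) _   _   = t≡3
        avoidBy⇒three (no  _)   k∉c k∈c = contradiction k∈c k∉c

      ∣D∣≡2 : ∣ D ∣ ≡ 2
      ∣D∣≡2 = suc-injective (trans (x∈p⇒suc∣p-x∣≡∣p∣ (x∈p∧x≢y⇒x∈p-y (x∉p⇒x∈∁p i∉β) i≢j₀)) ∣∁β-j₀∣≡3)

      private
        module _ {k} (k∈K : k ∈ K) (k-avoids : ∀ {j} → j ∈ D → k ∉ hits j) where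
          k∈c₀ : k ∈ c₀
          k∈c₀ = proj₁ (x∈p∩q⁻ c₀ (c i) k∈K)

          k∈cᵢ : k ∈ c i
          k∈cᵢ = proj₂ (x∈p∩q⁻ c₀ (c i) k∈K)

          k∈β : k ∈ β
          k∈β = C.c⊆β∪j j₀∉β k∈c₀ λ { refl → j₀∉β (C.c⊆β∪j i∉β k∈cᵢ (i≢j₀ ∘ sym)) }

          open Exchange b i∉β k∈β k∈cᵢ

          ∣c⊕cᵢ∣≡6 : ∀ {j} → j ∉ β → j ≢ i → k ∈ c j → ∣ c j ⊕ c i ∣ ≡ 6
          ∣c⊕cᵢ∣≡6 {j} j∉β j≢i k∈c with j Fin.≟ j₀
          ... | yes refl = ∣c₀⊕cᵢ∣≡6 i∉β i≢j₀
          ... | no  j≢j₀ = t≡3⇒∣c⊕cᵢ∣≡6 i∉β i≢j₀ j∉β j≢j₀ j≢i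
                             (avoidBy⇒three (∣ c j ∩ c i ∣ ≟ 3) (k-avoids j∈D) k∈c)
            where
              j∈D : j ∈ D
              j∈D = x∈p∧x≢y⇒x∈p-y (x∈p∧x≢y⇒x∈p-y (x∉p⇒x∈∁p j∉β) j≢j₀) j≢i

          ∣c∣≡6′ : ∀ {j} → j ∉ β → j ≢ i → k ∉ c j → ∣ c j ∣ ≡ 6
          ∣c∣≡6′ {j} j∉β _ k∉c with j Fin.≟ j₀
          ... | yes refl = contradiction k∈c₀ k∉c
          ... | no  j≢j₀ = ∣c∣≡6 j∉β j≢j₀

          exchangeAt : SixCircuitBasis L
          exchangeAt = basis′ , trans ∣β′∣≡∣β∣ ∣β∣≡8 , ∣c′∣ (∣c∣≡6 i∉β i≢j₀) ∣c⊕cᵢ∣≡6 ∣c∣≡6′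

      exchanged : SixCircuitBasis L
      exchanged
        with _ , k∈K , k-avoids ← uncovered hits K D (λ {j} j∈D → ∣K∩hitsBy∣≤1 j∈D (∣ c j ∩ c i ∣ ≟ 3))
                                    (subst₂ _<_ (sym ∣D∣≡2) (sym (∣c₀∩cᵢ∣≡4 i∉β i≢j₀)) (s≤s (s≤s (s≤s z≤n))))
        = exchangeAt k∈K k-avoids

  sixCircuitBasis : SixCircuitBasis L
  sixCircuitBasis with any? (λ j → ¬? (j ∈? β) ×-dec ¬? (∣ c j ∣ ≟ 6))
  ... | no  all-six = b , ∣β∣≡8 , ∣c∣≡6
    where
      ∣c∣≡6 : ∀ {j} → j ∉ β → ∣ c j ∣ ≡ 6
      ∣c∣≡6 {j} j∉β with ∣ c j ∣ ≟ 6
      ... | yes ∣c∣≡6 = ∣c∣≡6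
      ... | no  ∣c∣≢6 = contradiction (j , j∉β , ∣c∣≢6) all-six
  ... | yes (j₀ , j₀∉β , ∣c₀∣≢6) with ∣c∣≡6⊎8 j₀∉β
  ...   | inj₁ ∣c₀∣≡6 = contradiction ∣c₀∣≡6 ∣c₀∣≢6
  ...   | inj₂ ∣c₀∣≡8
    with i , i∈∁β-j₀ ← 0<∣p∣⇒Nonempty {p = ∁ β - j₀}
                           (subst (0 <_) (sym (Heavy.∣∁β-j₀∣≡3 j₀∉β ∣c₀∣≡8)) (s≤s z≤n))
    = Heavy.exchanged j₀∉β ∣c₀∣≡8 (x∈∁p⇒x∉p (p─q⊆p _ _ i∈∁β-j₀)) (x∈p-y⇒x≢y i∈∁β-j₀)

theorem7p1 : ∀ (n : ℕ) (S : List (Point n)) → IsKCap 12 S → HasDim S 7 →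
    ∃[ B ] (IsBasis B S × HasType5555 B S)
theorem7p1 n S (unique , ∣S∣≡12 , cap) dim with b , ∣β∣≡8 , ∣c∣≡6 ←
  Core.sixCircuitBasis ∣S∣≡12 (cap⇒girth≥6 unique cap) (basis S) (∣members∣≡d+1 (basis S) {7} dim) =
  select S (Basis.members b) , isBasis b , hasType5555 b (trans (cong (_+ 4) ∣β∣≡8) (sym ∣S∣≡12)) ∣c∣≡6
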